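{- Let $S\subseteq \mathbb{N}^d$ be a generalized numerical semigroup and $\mathbf{f}\in\mathbb{N}^d$. Then $S$ is irreducible with $EH(S)=\{\mathbf{f}\}$ if and only if $S$ is maximal with respect to inclusion in the set of generalized numerical semigroups in $\mathbb{N}^d$ not containing $\mathbf{f}$.
   Context: A generalized numerical semigroup (GNS) is a submonoid $S\subseteq\mathbb{N}^d$ such that $H(S)=\mathbb{N}^d\setminus S$ is finite. $EH(S)=\{\mathbf{x}\in H(S)\mid 2\mathbf{x}\in S \text{ and } \mathbf{x}+\mathbf{s}\in S \text{ for all } \mathbf{s}\in S\setminus\{\mathbf{0}\}\}$. $S$ is irreducible if it cannot be expressed as the intersection of two GNSs each properly containing $S$; an irreducible $S$ has exactly one special gap, which is called its Frobenius element. -}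

module Defs where

open import Data.Nat using (ℕ; _+_)
open import Data.Bool using (Bool; true; false)
open import Data.Vec using (Vec; zipWith; replicate)
open import Data.List using (List)
open import Data.List.Membership.Propositional using (_∈_)
open import Data.Product using (Σ; _×_; ∃)
open import Relation.Binary.PropositionalEquality using (_≡_)
open import Relation.Nullary using (¬_)

Point : ℕ → Set
Point d = Vec ℕ d

𝟎 : ∀ {d} → Point d
𝟎 {d} = replicate d 0

infixl 6 _⊕_
_⊕_ : ∀ {d} → Point d → Point d → Point d
_⊕_ = zipWith _+_

-- Subsets of ℕ^d, given by their (decidable) characteristic function.
-- (Any set with finite complement is decidable, so this loses no generality for GNSs.)
Subset : ℕ → Set
Subset d = Point d → Bool

_∈ₛ_ : ∀ {d} → Point d → Subset d → Set
x ∈ₛ S = S x ≡ true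

_∉ₛ_ : ∀ {d} → Point d → Subset d → Set
x ∉ₛ S = ¬ (x ∈ₛ S)

_⊆ₛ_ : ∀ {d} → Subset d → Subset d → Set
S ⊆ₛ T = ∀ x → x ∈ₛ S → x ∈ₛ T

_⊂ₛ_ : ∀ {d} → Subset d → Subset d → Set
S ⊂ₛ T = S ⊆ₛ T × Σ _ (λ x → x ∈ₛ T × x ∉ₛ S)

_≐_ : ∀ {d} → Subset d → Subset d → Set
S ≐ T = S ⊆ₛ T × T ⊆ₛ S

_∩_ : ∀ {d} → Subset d → Subset d → Subset d
(S ∩ T) x = Data.Bool._∧_ (S x) (T x)

FiniteComplement : ∀ {d} → Subset d → Set
FiniteComplement {d} S = Σ (List (Point d)) (λ L → ∀ x → x ∉ₛ S → x ∈ L)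

record IsGNS {d : ℕ} (S : Subset d) : Set where
  field
    zero∈ : 𝟎 ∈ₛ S
    closed : ∀ x y → x ∈ₛ S → y ∈ₛ S → (x ⊕ y) ∈ₛ S
    finiteGaps : FiniteComplement S

InEH : ∀ {d} → Subset d → Point d → Set
InEH S x = x ∉ₛ S × (x ⊕ x) ∈ₛ S × (∀ s → s ∈ₛ S → ¬ (s ≡ 𝟎) → (x ⊕ s) ∈ₛ S)

EHIsSingleton : ∀ {d} → Subset d → Point d → Set
EHIsSingleton S f = ∀ x → (InEH S x → x ≡ f) × (x ≡ f → InEH S x)

Irreducible : ∀ {d} → Subset d → Set
Irreducible {d} S = ¬ (Σ (Subset d) λ T₁ → Σ (Subset d) λ T₂ →
  IsGNS T₁ × IsGNS T₂ × S ⊂ₛ T₁ × S ⊂ₛ T₂ × S ≐ (T₁ ∩ T₂))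

MaximalAvoiding : ∀ {d} → Subset d → Point d → Set
MaximalAvoiding {d} S f = f ∉ₛ S ×
  (∀ (T : Subset d) → IsGNS T → f ∉ₛ T → S ⊆ₛ T → T ⊆ₛ S)

-- The proof rests on a descent principle.  Measure points by the sum of their
-- coordinates.  If a gap x of S is not in EH(S), then x ⊕ x or some x ⊕ s
-- (s ∈ S nonzero) is again a gap, of strictly larger norm.  Since the gaps
-- have bounded norm, this cannot go on forever: every property of points that
-- is inherited along these steps and holds for some gap also holds for some
-- element of EH(S) (contrapositively: if it fails on EH(S), it holds only
-- inside S).  Together with the fact that S ∪ {h} is a GNS for h ∈ EH(S):
--   * if EH(S) ⊆ {f} and f ∉ S, any GNS T ⊇ S avoiding f is S (descent
--     applied to "x ∈ T"), so S is maximal avoiding f;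
--   * if S is maximal avoiding f, every GNS properly above S contains f, so S
--     is irreducible; S ∪ {h} is such a GNS for h ∈ EH(S), h ≠ f, so
--     EH(S) ⊆ {f}; and descent applied to "norm f < norm x" shows f ∈ EH(S).
module Submission where

open import Defs
open import Data.Nat using (ℕ; zero; suc; _+_; _≤_; _<_)
open import Data.Nat.Properties
  using (+-identityʳ; +-comm; +-suc; +-commutativeSemigroup; m≤m+n; +-monoʳ-<;
         +-monoˡ-≤; n≢0⇒n>0; <⇒≱; ≤-trans; ≤-reflexive; module ≤-Reasoning)
open import Data.Product using (_×_; _,_; proj₁; proj₂)
open import Data.Sum using (_⊎_; inj₁; inj₂)
open import Data.Bool using (true; false; _∧_)
open import Data.Vec using ([]; _∷_; sum)
open import Data.Vec.Properties using (≡-dec; zipWith-comm; zipWith-identityʳ)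
open import Data.List.Relation.Unary.All as All using ()
open import Data.List.Extrema.Nat using (argmax; f[xs]≤f[argmax])
open import Data.Empty using (⊥-elim)
open import Relation.Nullary using (¬_; Dec; yes; no)
open import Relation.Binary.PropositionalEquality
open import Algebra.Properties.CommutativeSemigroup +-commutativeSemigroup
  using (interchange)

_≟ₚ_ : ∀ {d} (x y : Point d) → Dec (x ≡ y)
_≟ₚ_ = ≡-dec Data.Nat._≟_

⊕-comm : ∀ {d} (x y : Point d) → x ⊕ y ≡ y ⊕ x
⊕-comm = zipWith-comm +-comm

⊕-identityʳ : ∀ {d} (x : Point d) → x ⊕ 𝟎 ≡ x
⊕-identityʳ = zipWith-identityʳ +-identityʳ

norm : ∀ {d} → Point d → ℕ
norm = sum

norm-⊕ : ∀ {d} (x y : Point d) → norm (x ⊕ y) ≡ norm x + norm y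
norm-⊕ [] [] = refl
norm-⊕ (a ∷ x) (b ∷ y) = begin
  (a + b) + norm (x ⊕ y)       ≡⟨ cong ((a + b) +_) (norm-⊕ x y) ⟩
  (a + b) + (norm x + norm y)  ≡⟨ interchange a b (norm x) (norm y) ⟩
  (a + norm x) + (b + norm y)  ∎
  where open ≡-Reasoning

norm≡0⇒𝟎 : ∀ {d} (x : Point d) → norm x ≡ 0 → x ≡ 𝟎
norm≡0⇒𝟎 [] _ = refl
norm≡0⇒𝟎 (zero ∷ x) e = cong (0 ∷_) (norm≡0⇒𝟎 x e)

nonzero⇒norm>0 : ∀ {d} (x : Point d) → ¬ x ≡ 𝟎 → 0 < norm x
nonzero⇒norm>0 x x≢𝟎 = n≢0⇒n>0 (λ e → x≢𝟎 (norm≡0⇒𝟎 x e))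

norm-≤-⊕ : ∀ {d} (x y : Point d) → norm x ≤ norm (x ⊕ y)
norm-≤-⊕ x y rewrite norm-⊕ x y = m≤m+n (norm x) (norm y)

norm-<-⊕ : ∀ {d} (x y : Point d) → 0 < norm y → norm x < norm (x ⊕ y)
norm-<-⊕ x y 0<y rewrite norm-⊕ x y =
  subst (_< norm x + norm y) (+-identityʳ (norm x)) (+-monoʳ-< (norm x) 0<y)

∈ₛ-stable : ∀ {d} (S : Subset d) x → ¬ x ∉ₛ S → x ∈ₛ S
∈ₛ-stable S x ¬x∉S with S x
... | true = refl
... | false = ⊥-elim (¬x∉S λ ())

adjoin : ∀ {d} → Subset d → Point d → Subset d
adjoin S x y with y ≟ₚ x
... | yes _ = true
... | no _ = S y

adjoin-⊇ : ∀ {d} (S : Subset d) x y → y ∈ₛ S → y ∈ₛ adjoin S x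
adjoin-⊇ S x y y∈S with y ≟ₚ x
... | yes _ = refl
... | no _ = y∈S

adjoin-new : ∀ {d} (S : Subset d) x → x ∈ₛ adjoin S x
adjoin-new S x with x ≟ₚ x
... | yes _ = refl
... | no x≢x = ⊥-elim (x≢x refl)

adjoin-cases : ∀ {d} (S : Subset d) x y → y ∈ₛ adjoin S x → y ≡ x ⊎ y ∈ₛ S
adjoin-cases S x y y∈ with y ≟ₚ x
... | yes y≡x = inj₁ y≡x
... | no _ = inj₂ y∈

-- Maximality among GNSs avoiding f makes every GNS strictly above S contain f;
-- hence an intersection of two of them contains f and cannot be S.
maximal⇒irreducible : ∀ {d} {S : Subset d} {f} → MaximalAvoiding S f → Irreducible S
maximal⇒irreducible {S = S} {f} (f∉S , maximal)
  (T₁ , T₂ , gns₁ , gns₂ , (S⊆T₁ , x₁ , x₁∈T₁ , x₁∉S) , (S⊆T₂ , x₂ , x₂∈T₂ , x₂∉S) , _ , T₁∩T₂⊆S) =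
  f∉S (T₁∩T₂⊆S f (∧-true (contains-f gns₁ S⊆T₁ x₁ x₁∈T₁ x₁∉S)
                         (contains-f gns₂ S⊆T₂ x₂ x₂∈T₂ x₂∉S)))
  where
  contains-f : ∀ {T} → IsGNS T → S ⊆ₛ T → ∀ x → x ∈ₛ T → x ∉ₛ S → f ∈ₛ T
  contains-f {T} gns S⊆T x x∈T x∉S =
    ∈ₛ-stable T f λ f∉T → x∉S (maximal T gns f∉T S⊆T x x∈T)

  ∧-true : ∀ {a b} → a ≡ true → b ≡ true → a ∧ b ≡ true
  ∧-true refl refl = refl

module _ {d : ℕ} {S : Subset d} (gns : IsGNS S) where
  open IsGNS gns

  adjoin-GNS : ∀ x → (x ⊕ x) ∈ₛ S → (∀ s → s ∈ₛ S → ¬ s ≡ 𝟎 → (x ⊕ s) ∈ₛ S) →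
               IsGNS (adjoin S x)
  adjoin-GNS x 2x∈S absorbs = record
    { zero∈ = adjoin-⊇ S x 𝟎 zero∈
    ; closed = closed′
    ; finiteGaps = proj₁ finiteGaps ,
        λ y y∉ → proj₂ finiteGaps y (λ y∈S → y∉ (adjoin-⊇ S x y y∈S))
    }
    where
    x+S : ∀ s → s ∈ₛ S → (x ⊕ s) ∈ₛ adjoin S x
    x+S s s∈S with s ≟ₚ 𝟎
    ... | yes refl = subst (_∈ₛ adjoin S x) (sym (⊕-identityʳ x)) (adjoin-new S x)
    ... | no s≢𝟎 = adjoin-⊇ S x _ (absorbs s s∈S s≢𝟎)

    closed′ : ∀ y z → y ∈ₛ adjoin S x → z ∈ₛ adjoin S x → (y ⊕ z) ∈ₛ adjoin S x
    closed′ y z y∈ z∈ with adjoin-cases S x y y∈ | adjoin-cases S x z z∈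
    ... | inj₁ refl | inj₁ refl = adjoin-⊇ S x _ 2x∈S
    ... | inj₁ refl | inj₂ z∈S = x+S z z∈S
    ... | inj₂ y∈S | inj₁ refl = subst (_∈ₛ adjoin S x) (⊕-comm x y) (x+S y y∈S)
    ... | inj₂ y∈S | inj₂ z∈S = adjoin-⊇ S x _ (closed y z y∈S z∈S)

  gap-norm>0 : ∀ x → x ∉ₛ S → 0 < norm x
  gap-norm>0 x x∉S = nonzero⇒norm>0 x (λ { refl → x∉S zero∈ })

  gapBound : ℕ
  gapBound = norm (argmax norm 𝟎 (proj₁ finiteGaps))

  gap-norm≤bound : ∀ x → x ∉ₛ S → norm x ≤ gapBound
  gap-norm≤bound x x∉S =
    All.lookup (f[xs]≤f[argmax] 𝟎 (proj₁ finiteGaps)) (proj₂ finiteGaps x x∉S)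

  -- The fuel n bounds how far the norm of x may still be below the gap bound.
  module Descent (P : Point d → Set)
                 (P-double : ∀ x → P x → P (x ⊕ x))
                 (P-shift : ∀ x s → s ∈ₛ S → P x → P (x ⊕ s))
                 (P∉EH : ∀ h → InEH S h → ¬ P h) where

    descend : ∀ n x → gapBound < norm x + n → P x → x ∈ₛ S
    descend zero x bound<x _ = ∈ₛ-stable S x λ x∉S →
      <⇒≱ (subst (gapBound <_) (+-identityʳ (norm x)) bound<x) (gap-norm≤bound x x∉S)
    descend (suc n) x bound<x Px = ∈ₛ-stable S x λ x∉S →
      P∉EH x (x∉S , descend n (x ⊕ x) (step x (gap-norm>0 x x∉S)) (P-double x Px) , absorbs) Px
      where
      step : ∀ y → 0 < norm y → gapBound < norm (x ⊕ y) + n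
      step y 0<y = begin-strict
        gapBound             <⟨ bound<x ⟩
        norm x + suc n       ≡⟨ +-suc (norm x) n ⟩
        suc (norm x) + n     ≤⟨ +-monoˡ-≤ n (norm-<-⊕ x y 0<y) ⟩
        norm (x ⊕ y) + n     ∎
        where open ≤-Reasoning

      absorbs : ∀ s → s ∈ₛ S → ¬ s ≡ 𝟎 → (x ⊕ s) ∈ₛ S
      absorbs s s∈S s≢𝟎 =
        descend n (x ⊕ s) (step s (nonzero⇒norm>0 s s≢𝟎)) (P-shift x s s∈S Px)

    descent : ∀ x → P x → x ∈ₛ S
    descent x = descend (suc gapBound) x (begin-strict
      gapBound                 <⟨ m≤m+n (suc gapBound) (norm x) ⟩
      suc gapBound + norm x    ≡⟨ +-comm (suc gapBound) (norm x) ⟩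
      norm x + suc gapBound    ∎)
      where open ≤-Reasoning

  -- If f is a gap and EH(S) ⊆ {f}, then no GNS strictly above S avoids f:
  -- descent along "x ∈ T" shows T ⊆ S.
  EH⊆f⇒maximal : ∀ f → f ∉ₛ S → (∀ h → InEH S h → h ≡ f) → MaximalAvoiding S f
  EH⊆f⇒maximal f f∉S EH⊆f = f∉S , λ T gnsT f∉T S⊆T →
    Descent.descent (_∈ₛ T)
      (λ x x∈T → IsGNS.closed gnsT x x x∈T x∈T)
      (λ x s s∈S x∈T → IsGNS.closed gnsT x s x∈T (S⊆T s s∈S))
      (λ h h∈EH h∈T → f∉T (subst (_∈ₛ T) (EH⊆f h h∈EH) h∈T))

  -- If S is maximal avoiding f, then S ∪ {h} for h ∈ EH(S), h ≠ f would be a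
  -- larger GNS avoiding f; so EH(S) ⊆ {f}.
  maximal⇒EH⊆f : ∀ {f} → MaximalAvoiding S f → ∀ h → InEH S h → h ≡ f
  maximal⇒EH⊆f {f} (f∉S , maximal) h (h∉S , 2h∈S , absorbs) with h ≟ₚ f
  ... | yes h≡f = h≡f
  ... | no h≢f = ⊥-elim (h∉S (maximal (adjoin S h) (adjoin-GNS h 2h∈S absorbs)
          f∉S∪h (adjoin-⊇ S h) h (adjoin-new S h)))
    where
    f∉S∪h : f ∉ₛ adjoin S h
    f∉S∪h f∈ with adjoin-cases S h f f∈
    ... | inj₁ f≡h = h≢f (sym f≡h)
    ... | inj₂ f∈S = f∉S f∈S

  -- A gap f that is the only candidate for EH(S) belongs to EH(S): descent
  -- along "norm f < norm x" shows every point strictly above f lies in S.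
  sole-candidate∈EH : ∀ f → f ∉ₛ S → (∀ h → InEH S h → h ≡ f) → InEH S f
  sole-candidate∈EH f f∉S EH⊆f =
    f∉S , above-f f (gap-norm>0 f f∉S) , λ s s∈S s≢𝟎 → above-f s (nonzero⇒norm>0 s s≢𝟎)
    where
    above-f : ∀ y → 0 < norm y → (f ⊕ y) ∈ₛ S
    above-f y 0<y = Descent.descent (λ x → norm f < norm x)
      (λ x f<x → ≤-trans f<x (norm-≤-⊕ x x))
      (λ x s _ f<x → ≤-trans f<x (norm-≤-⊕ x s))
      (λ h h∈EH f<h → <⇒≱ f<h (≤-reflexive (cong norm (EH⊆f h h∈EH))))
      (f ⊕ y) (norm-<-⊕ f y 0<y)

mainTheorem17 : (d : ℕ) (S : Subset d) (f : Point d) → IsGNS S →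
    ((Irreducible S × EHIsSingleton S f) → MaximalAvoiding S f)
    × (MaximalAvoiding S f → (Irreducible S × EHIsSingleton S f))
mainTheorem17 d S f gns = irreducible⇒maximal , maximal⇒irreducible-EH
  where
  irreducible⇒maximal : Irreducible S × EHIsSingleton S f → MaximalAvoiding S f
  irreducible⇒maximal (_ , EH≡f) =
    EH⊆f⇒maximal gns f (proj₁ (proj₂ (EH≡f f) refl)) (λ h → proj₁ (EH≡f h))

  maximal⇒irreducible-EH : MaximalAvoiding S f → Irreducible S × EHIsSingleton S f
  maximal⇒irreducible-EH max@(f∉S , _) = maximal⇒irreducible max ,
    λ h → EH⊆f h , λ { refl → sole-candidate∈EH gns f f∉S EH⊆f }
    where
    EH⊆f : ∀ h → InEH S h → h ≡ f
    EH⊆f = maximal⇒EH⊆f gns max
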